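{- Let $G$ be the unit interval graph on $[n]$ determined by intervals $[a_1,1],\ldots,[a_n,n]$. Then $$Y_G=\sum_{D\in\mathcal A(G)}(-1)^{a(D)}\,e_1\uparrow_D .$$
   Context: Unit interval graph: for integers $1\le a_k\le k$, the graph on $[n]$ where distinct $i,j$ are adjacent iff $i,j\in[a_k,k]=\{a_k,\ldots,k\}$ for some $k$. Non-commuting variables $x_1,x_2,\ldots$; $Y_G=\sum_\kappa x_{\kappa(1)}\cdots x_{\kappa(n)}$ over proper colorings $\kappa:[n]\to\{1,2,\ldots\}$. $e_1=p_1=x_1+x_2+\cdots$. Induction: for $1\le j<N$, $x_{i_1}\cdots x_{i_{N-1}}\uparrow_j^N=x_{i_1}\cdots x_{i_{N-1}}x_{i_j}$, extended linearly, and $f\uparrow_N^N=f\,p_1$. An arc diagram on $[n]$ is a set of arcs $(i,j)$ with $i<j$; the arc $(i,j)$ is a left arc of $j$. $\mathcal A(G)$ is the set of arc diagrams on $[n]$ such that every vertex has at most one left arc and for each arc $(i,j)$ there is $k$ with $i,j\in[a_k,k]$. For $D\in\mathcal A(G)$ and $2\le j\le n$ let $i_j$ be the left endpoint of the left arc of $j$ if it exists and $i_j=j$ otherwise; set $e_1\uparrow_D=e_1\uparrow_{i_2}^2\uparrow_{i_3}^3\cdots\uparrow_{i_n}^n$ (applied successively left to right). $a(D)$ is the number of arcs of $D$. -}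

module Defs where

open import Data.Bool using (Bool; true; false; _∧_; _∨_; not; if_then_else_)
open import Data.Nat using (ℕ; zero; suc; _∸_; _+_; _≡ᵇ_; _≤ᵇ_; _<ᵇ_)
open import Data.Integer using (ℤ; 0ℤ; 1ℤ; -1ℤ; _^_) renaming (_+_ to _+ℤ_; _*_ to _*ℤ_)
open import Data.List using (List; []; _∷_; length; map; filter; foldr; applyUpTo; concatMap; unsnoc)
open import Data.Bool.ListAction using (all; any)
open import Data.Maybe using (Maybe; just; nothing)
open import Data.Product using (_×_; _,_)

-- Noncommutative formal power series in x_1, x_2, ...
-- A word is a list of letters; the letter c : ℕ stands for the variable
-- x_(c+1) (so letters range over all variables x_1, x_2, ...).

Word : Set
Word = List ℕ

Series : Set
Series = Word → ℤ

-- 1-indexed letter of a word: nth w j = w_j (nothing if out of range)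
nth : Word → ℕ → Maybe ℕ
nth []       _             = nothing
nth (x ∷ xs) zero          = nothing
nth (x ∷ xs) (suc zero)    = just x
nth (x ∷ xs) (suc (suc j)) = nth xs (suc j)

eqMaybe : Maybe ℕ → Maybe ℕ → Bool
eqMaybe (just x) (just y) = x ≡ᵇ y
eqMaybe _        _        = false

e₁ : Series
e₁ (c ∷ []) = 1ℤ
e₁ _        = 0ℤ

-- Induction f ↑_j^N (linear extension of the map on monomials).
-- For 1 ≤ j < N: x_{i1}⋯x_{i(N-1)} ↦ x_{i1}⋯x_{i(N-1)} x_{ij}; the coefficient
-- of a word u = v c is f(v) if |v| = N-1 and c = v_j, and 0 otherwise.
-- For j = N: f ↑_N^N = f p₁, whose coefficient of u = v c is f(v).
ind : ℕ → ℕ → Series → Series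
ind j N f u with unsnoc u
... | nothing     = 0ℤ
... | just (v , c) =
  if j ≡ᵇ N then f v
  else (if (j <ᵇ N) ∧ (1 ≤ᵇ j) ∧ (length v ≡ᵇ (N ∸ 1)) ∧ eqMaybe (nth v j) (just c)
        then f v else 0ℤ)

-- Unit interval graph on [n] = {1,…,n} given by a : ℕ → ℕ (only a 1,…,a n used)

range : ℕ → List ℕ
range n = applyUpTo suc n

inIv : ℕ → ℕ → ℕ → Bool
inIv lo hi x = (lo ≤ᵇ x) ∧ (x ≤ᵇ hi)

sameInterval : (a : ℕ → ℕ) → ℕ → ℕ → ℕ → Bool
sameInterval a n i j = any (λ k → inIv (a k) k i ∧ inIv (a k) k j) (range n)

adj : (a : ℕ → ℕ) → ℕ → ℕ → ℕ → Bool
adj a n i j = not (i ≡ᵇ j) ∧ sameInterval a n i j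

-- a word w of length n, read as the coloring κ(i) = w_i, is proper
proper : (a : ℕ → ℕ) → ℕ → Word → Bool
proper a n w = all (λ i → all (λ j → not (adj a n i j) ∨ not (eqMaybe (nth w i) (nth w j)))
                               (range n)) (range n)

-- Y_G = Σ_κ x_κ(1)⋯x_κ(n): coefficient of a word is 1 iff it is (the word of)
-- a proper coloring of [n], else 0 (distinct colorings give distinct words).
Y : (a : ℕ → ℕ) → ℕ → Series
Y a n w = if (length w ≡ᵇ n) ∧ proper a n w then 1ℤ else 0ℤ

-- Arc diagrams on [n]: sets of arcs (i , j) with 1 ≤ i < j ≤ n, encoded as
-- sublists of the canonical list of all such arcs (distinct sublists ↔ distinct sets).

allArcs : ℕ → List (ℕ × ℕ)
allArcs n = concatMap (λ j → map (λ i → (i , j)) (range (j ∸ 1))) (range n)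

sublists : {A : Set} → List A → List (List A)
sublists []       = [] ∷ []
sublists (x ∷ xs) = let r = sublists xs in map (x ∷_) r Data.List.++ r

ArcDiagram : Set
ArcDiagram = List (ℕ × ℕ)

arcDiagrams : ℕ → List ArcDiagram
arcDiagrams n = sublists (allArcs n)

leftArcCount : ArcDiagram → ℕ → ℕ
leftArcCount D j = length (filter (λ { (i , k) → Data.Bool._≟_ (k ≡ᵇ j) true }) D)

inA : (a : ℕ → ℕ) → ℕ → ArcDiagram → Bool
inA a n D = all (λ j → leftArcCount D j ≤ᵇ 1) (range n)
          ∧ all (λ { (i , j) → sameInterval a n i j }) D

𝒜 : (a : ℕ → ℕ) → ℕ → List ArcDiagram
𝒜 a n = filter (λ D → Data.Bool._≟_ (inA a n D) true) (arcDiagrams n)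

leftEnd : ArcDiagram → ℕ → ℕ
leftEnd []            j = j
leftEnd ((i , k) ∷ D) j = if k ≡ᵇ j then i else leftEnd D j

e₁↑ : ArcDiagram → ℕ → Series
e₁↑ D zero    = e₁
e₁↑ D (suc m) = ind (leftEnd D (suc (suc m))) (suc (suc m)) (e₁↑ D m)

e₁↑_D : ArcDiagram → ℕ → Series
e₁↑_D D n = e₁↑ D (n ∸ 1)

arcCount : ArcDiagram → ℕ
arcCount D = length D

sumℤ : List ℤ → ℤ
sumℤ = foldr _+ℤ_ 0ℤ

RHS : (a : ℕ → ℕ) → ℕ → Series
RHS a n w = sumℤ (map (λ D → (-1ℤ ^ arcCount D) *ℤ e₁↑_D D n w) (𝒜 a n))

-- Induct on the number of vertices, splitting a word as v c. A diagram in 𝒜 on [N] is a diagram s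
-- on [N − 1] plus at most one left arc (i , N). The last induction ↑_N^N carries the coefficient
-- of v in e₁↑_s to that of v c, while ↑_i^N does so only when v_i = c, and the extra arc costs a
-- sign. So the signed sum on [N] at v c is (1 − #{i < N : i, N share an interval, v_i = c}) times
-- the signed sum on [N − 1] at v. The left neighbours of N form a clique, so a proper colouring v
-- gives colour c to at most one of them, and the factor is the indicator that v c is proper.
module Submission where

open import Defs
open import Data.Bool using (Bool; true; false; _∧_; _∨_; not; if_then_else_; T; _≟_)
import Data.Bool.Properties as BP
import Algebra.Bundles
open import Algebra.Lattice.Properties.BooleanAlgebra BP.∨-∧-booleanAlgebra using (deMorgan₁)
open import Algebra.Properties.CommutativeSemigroup (Algebra.Bundles.CommutativeMonoid.commutativeSemigroup BP.∧-commutativeMonoid) using (interchange)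
open import Data.Nat using (ℕ; zero; suc; _+_; _∸_; _≡ᵇ_; _≤ᵇ_; _<ᵇ_; _≤_; _<_; z≤n; s≤s)
import Data.Nat.Properties as NP
open import Data.Integer using (ℤ; 0ℤ; 1ℤ; -1ℤ; _^_; -_) renaming (_+_ to _+ℤ_; _*_ to _*ℤ_; _-_ to _-ℤ_)
import Data.Integer.Properties as ZP
open import Data.Integer.Tactic.RingSolver using (solve-∀)
open import Data.List using (List; []; _∷_; length; map; filter; concatMap; unsnoc; _++_; [_]; _∷ʳ_; InitLast; initLast; _∷ʳ′_)
import Data.List.Properties as LP
open import Data.List.Relation.Unary.All as All using (All; []; _∷_)
import Data.List.Relation.Unary.All.Properties as AllP
open import Data.List.Relation.Unary.AllPairs using (AllPairs; []; _∷_)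
import Data.List.Relation.Unary.AllPairs.Properties as AllPairsP
import Data.List.Relation.Unary.Any.Properties as AnyP
open import Data.List.Membership.Propositional using (_∈_; find; lose)
open import Data.List.Membership.Propositional.Properties using (∈-applyUpTo⁺)
open import Data.Bool.ListAction using (all; or)
open import Data.Maybe using (just; nothing)
open import Data.Product using (_×_; _,_; proj₁; proj₂)
open import Data.Sum using (inj₁; inj₂)
open import Function using (_∘_; Equivalence)
open import Relation.Binary.PropositionalEquality hiding ([_])
open import Relation.Nullary using (yes; no)
open import Data.Empty using (⊥-elim)

variable
  A B : Set

𝟙 : Bool → ℤ
𝟙 b = if b then 1ℤ else 0ℤ

sumℤ-++ : ∀ xs ys → sumℤ (xs ++ ys) ≡ sumℤ xs +ℤ sumℤ ys
sumℤ-++ []       ys = sym (ZP.+-identityˡ _)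
sumℤ-++ (x ∷ xs) ys = trans (cong (x +ℤ_) (sumℤ-++ xs ys)) (sym (ZP.+-assoc x _ _))

sumℤ-map-∘ : (g : B → ℤ) (f : A → B) (xs : List A) →
  sumℤ (map g (map f xs)) ≡ sumℤ (map (g ∘ f) xs)
sumℤ-map-∘ g f xs = cong sumℤ (sym (LP.map-∘ xs))

sumℤ-map-++ : (g : A → ℤ) (xs ys : List A) →
  sumℤ (map g (xs ++ ys)) ≡ sumℤ (map g xs) +ℤ sumℤ (map g ys)
sumℤ-map-++ g xs ys = trans (cong sumℤ (LP.map-++ g xs ys)) (sumℤ-++ (map g xs) (map g ys))

sumℤ-map-cong : {g h : A → ℤ} (xs : List A) → All (λ x → g x ≡ h x) xs →
  sumℤ (map g xs) ≡ sumℤ (map h xs)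
sumℤ-map-cong []       []       = refl
sumℤ-map-cong (x ∷ xs) (e ∷ es) = cong₂ _+ℤ_ e (sumℤ-map-cong xs es)

sumℤ-map-zero : {g : A → ℤ} (xs : List A) → All (λ x → g x ≡ 0ℤ) xs → sumℤ (map g xs) ≡ 0ℤ
sumℤ-map-zero []       []       = refl
sumℤ-map-zero (x ∷ xs) (e ∷ es) = cong₂ _+ℤ_ e (sumℤ-map-zero xs es)

sumℤ-map-*ʳ : (c : ℤ) (g : A → ℤ) (xs : List A) →
  sumℤ (map (λ x → g x *ℤ c) xs) ≡ sumℤ (map g xs) *ℤ c
sumℤ-map-*ʳ c g []       = sym (ZP.*-zeroˡ c)
sumℤ-map-*ʳ c g (x ∷ xs) =
  trans (cong (g x *ℤ c +ℤ_) (sumℤ-map-*ʳ c g xs)) (sym (ZP.*-distribʳ-+ c (g x) _))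

sumℤ-map-*ˡ : (c : ℤ) (g : A → ℤ) (xs : List A) →
  sumℤ (map (λ x → c *ℤ g x) xs) ≡ c *ℤ sumℤ (map g xs)
sumℤ-map-*ˡ c g []       = sym (ZP.*-zeroʳ c)
sumℤ-map-*ˡ c g (x ∷ xs) =
  trans (cong (c *ℤ g x +ℤ_) (sumℤ-map-*ˡ c g xs)) (sym (ZP.*-distribˡ-+ c (g x) _))

sumℤ-map-filter : (p : A → Bool) (h : A → ℤ) (xs : List A) →
  sumℤ (map h (filter (λ x → p x ≟ true) xs)) ≡ sumℤ (map (λ x → if p x then h x else 0ℤ) xs)
sumℤ-map-filter p h []       = refl
sumℤ-map-filter p h (x ∷ xs) with p x
... | true  = cong (h x +ℤ_) (sumℤ-map-filter p h xs)
... | false = trans (sumℤ-map-filter p h xs) (sym (ZP.+-identityˡ _))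

All-sublists : {Q : A → Set} (xs : List A) → All Q xs → All (All Q) (sublists xs)
All-sublists []       []       = [] ∷ []
All-sublists (x ∷ xs) (q ∷ qs) =
  AllP.++⁺ (AllP.map⁺ (All.map (q ∷_) (All-sublists xs qs))) (All-sublists xs qs)

sumℤ-sublists-++ : (h : List A → ℤ) (xs ys : List A) →
  sumℤ (map h (sublists (xs ++ ys))) ≡
  sumℤ (map (λ s → sumℤ (map (λ t → h (s ++ t)) (sublists ys))) (sublists xs))
sumℤ-sublists-++ h []       ys = sym (ZP.+-identityʳ _)
sumℤ-sublists-++ {A = A} h (x ∷ xs) ys = begin
    sumℤ (map h (map (x ∷_) r ++ r))
  ≡⟨ sumℤ-map-++ h (map (x ∷_) r) r ⟩
    sumℤ (map h (map (x ∷_) r)) +ℤ sumℤ (map h r)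
  ≡⟨ cong₂ _+ℤ_ (trans (sumℤ-map-∘ h (x ∷_) r) (sumℤ-sublists-++ (h ∘ (x ∷_)) xs ys))
                (sumℤ-sublists-++ h xs ys) ⟩
    sumℤ (map (G ∘ (x ∷_)) R) +ℤ sumℤ (map G R)
  ≡⟨ cong (_+ℤ sumℤ (map G R)) (sym (sumℤ-map-∘ G (x ∷_) R)) ⟩
    sumℤ (map G (map (x ∷_) R)) +ℤ sumℤ (map G R)
  ≡⟨ sym (sumℤ-map-++ G (map (x ∷_) R) R) ⟩
    sumℤ (map G (map (x ∷_) R ++ R))
  ∎
  where
  open ≡-Reasoning
  r R : List (List A)
  r = sublists (xs ++ ys)
  R = sublists xs
  G : List A → ℤ
  G s = sumℤ (map (λ t → h (s ++ t)) (sublists ys))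

sumℤ-sublists-singletons : (Q : A → Set) (F : List A → ℤ) (xs : List A) → All Q xs →
  (∀ t → All Q t → 2 ≤ length t → F t ≡ 0ℤ) →
  sumℤ (map F (sublists xs)) ≡ F [] +ℤ sumℤ (map (λ x → F [ x ]) xs)
sumℤ-sublists-singletons Q F []       []       vanish = refl
sumℤ-sublists-singletons {A = A} Q F (x ∷ xs) (q ∷ qs) vanish = begin
    sumℤ (map F (map (x ∷_) r ++ r))
  ≡⟨ sumℤ-map-++ F (map (x ∷_) r) r ⟩
    sumℤ (map F (map (x ∷_) r)) +ℤ sumℤ (map F r)
  ≡⟨ cong₂ _+ℤ_ (trans (sumℤ-map-∘ F (x ∷_) r)
                       (sumℤ-sublists-singletons Q (F ∘ (x ∷_)) xs qs
                          (λ t qt l → vanish (x ∷ t) (q ∷ qt) (NP.m≤n⇒m≤1+n l))))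
                (sumℤ-sublists-singletons Q F xs qs vanish) ⟩
    (F [ x ] +ℤ sumℤ (map (λ y → F (x ∷ [ y ])) xs)) +ℤ (F [] +ℤ S)
  ≡⟨ cong (λ z → (F [ x ] +ℤ z) +ℤ (F [] +ℤ S))
          (sumℤ-map-zero xs (All.map (λ qy → vanish (x ∷ [ _ ]) (q ∷ qy ∷ []) (s≤s (s≤s z≤n))) qs)) ⟩
    (F [ x ] +ℤ 0ℤ) +ℤ (F [] +ℤ S)
  ≡⟨ rearrange (F [ x ]) (F []) S ⟩
    F [] +ℤ (F [ x ] +ℤ S)
  ∎
  where
  open ≡-Reasoning
  r : List (List A)
  r = sublists xs
  S : ℤ
  S = sumℤ (map (λ y → F [ y ]) xs)
  rearrange : ∀ p q s → (p +ℤ 0ℤ) +ℤ (q +ℤ s) ≡ q +ℤ (p +ℤ s)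
  rearrange = solve-∀

𝟙-none-exclusive : (b : A → Bool) (xs : List A) → AllPairs (λ x y → b x ∧ b y ≡ false) xs →
  𝟙 (all (not ∘ b) xs) ≡ 1ℤ -ℤ sumℤ (map (𝟙 ∘ b) xs)
𝟙-none-exclusive b []       []         = refl
𝟙-none-exclusive b (x ∷ xs) (bx ∷ bxs) with b x
... | true  rewrite sumℤ-map-zero {g = 𝟙 ∘ b} xs (All.map (cong 𝟙) bx) = refl
... | false = trans (𝟙-none-exclusive b xs bxs) (cong (1ℤ -ℤ_) (sym (ZP.+-identityˡ (sumℤ (map (𝟙 ∘ b) xs)))))

T⇒≡ : ∀ {b} → T b → b ≡ true
T⇒≡ = Equivalence.to BP.T-≡

≡⇒T : ∀ {b} → b ≡ true → T b
≡⇒T = Equivalence.from BP.T-≡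

≡ᵇ-refl : ∀ n → (n ≡ᵇ n) ≡ true
≡ᵇ-refl n = T⇒≡ (NP.≡⇒≡ᵇ n n refl)

≢⇒≡ᵇ-false : ∀ {m n} → m ≢ n → (m ≡ᵇ n) ≡ false
≢⇒≡ᵇ-false {m} {n} m≢n = BP.¬-not (m≢n ∘ NP.≡ᵇ⇒≡ m n ∘ ≡⇒T)

≡ᵇ-sym : ∀ m n → (m ≡ᵇ n) ≡ (n ≡ᵇ m)
≡ᵇ-sym zero    zero    = refl
≡ᵇ-sym zero    (suc n) = refl
≡ᵇ-sym (suc m) zero    = refl
≡ᵇ-sym (suc m) (suc n) = ≡ᵇ-sym m n

<⇒<ᵇ-true : ∀ {m n} → m < n → (m <ᵇ n) ≡ true
<⇒<ᵇ-true = T⇒≡ ∘ NP.<⇒<ᵇ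

∧-true⁻ : ∀ {x y} → x ∧ y ≡ true → x ≡ true × y ≡ true
∧-true⁻ {true} {true} _ = refl , refl

all-∈ : {p : A → Bool} {xs : List A} {x : A} → all p xs ≡ true → x ∈ xs → p x ≡ true
all-∈ {p = p} {xs} e x∈xs = T⇒≡ (All.lookup (AllP.all⁺ p xs (≡⇒T e)) x∈xs)

all-true : {p : A → Bool} (xs : List A) → All (λ x → p x ≡ true) xs → all p xs ≡ true
all-true {p = p} xs ps = T⇒≡ (AllP.all⁻ p (All.map ≡⇒T ps))

all-false : {p : A → Bool} {xs : List A} {x : A} → x ∈ xs → p x ≡ false → all p xs ≡ false
all-false x∈xs px = BP.¬-not (λ e → BP.not-¬ px (all-∈ e x∈xs))

all-cong : {p q : A → Bool} (xs : List A) → All (λ x → p x ≡ q x) xs → all p xs ≡ all q xs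
all-cong []       []       = refl
all-cong (x ∷ xs) (e ∷ es) = cong₂ _∧_ e (all-cong xs es)

all-++ : (p : A → Bool) (xs ys : List A) → all p (xs ++ ys) ≡ all p xs ∧ all p ys
all-++ p []       ys = refl
all-++ p (x ∷ xs) ys = trans (cong (p x ∧_) (all-++ p xs ys)) (sym (BP.∧-assoc (p x) _ _))

all-∧ : (p q : A → Bool) (xs : List A) → all (λ x → p x ∧ q x) xs ≡ all p xs ∧ all q xs
all-∧ p q []       = refl
all-∧ p q (x ∷ xs) = trans (cong ((p x ∧ q x) ∧_) (all-∧ p q xs)) (interchange (p x) (q x) _ _)

range-suc : ∀ k → range (suc k) ≡ range k ∷ʳ suc k
range-suc k = sym (LP.applyUpTo-∷ʳ suc k)

range-bounds : ∀ k → All (λ i → 1 ≤ i × i ≤ k) (range k)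
range-bounds k = AllP.applyUpTo⁺₁ suc k (λ i<k → s≤s z≤n , i<k)

∈-range⁺ : ∀ {i k} → i < k → suc i ∈ range k
∈-range⁺ = ∈-applyUpTo⁺ suc

∈-range⁻ : ∀ {i k} → i ∈ range k → 1 ≤ i × i ≤ k
∈-range⁻ {k = k} = All.lookup (range-bounds k)

arcsInto : ℕ → List (ℕ × ℕ)
arcsInto j = map (λ i → (i , j)) (range (j ∸ 1))

allArcs-suc : ∀ k → allArcs (suc k) ≡ allArcs k ++ arcsInto (suc k)
allArcs-suc k = trans (cong (concatMap arcsInto) (range-suc k))
                      (trans (LP.concatMap-++ arcsInto (range k) [ suc k ]) (cong (allArcs k ++_) (LP.++-identityʳ _)))

EndsBy : ℕ → ArcDiagram → Set
EndsBy k D = All (λ x → proj₂ x ≤ k) D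

allArcs-endsBy : ∀ k → EndsBy k (allArcs k)
allArcs-endsBy zero    = []
allArcs-endsBy (suc k) rewrite allArcs-suc k =
  AllP.++⁺ (All.map NP.m≤n⇒m≤1+n (allArcs-endsBy k)) (AllP.map⁺ (AllP.applyUpTo⁺₂ suc k (λ _ → NP.≤-refl)))

arcsInto-target : ∀ j → All (λ x → proj₂ x ≡ j) (arcsInto j)
arcsInto-target j = AllP.map⁺ (AllP.applyUpTo⁺₂ suc (j ∸ 1) (λ _ → refl))

endsBy⇒avoids : ∀ {k j D} → EndsBy k D → k < j → All (λ x → proj₂ x ≢ j) D
endsBy⇒avoids D≤k k<j = All.map (λ x≤k x≡j → NP.<⇒≱ k<j (subst (_≤ _) x≡j x≤k)) D≤k

leftArcCount-++ : ∀ s t j → leftArcCount (s ++ t) j ≡ leftArcCount s j + leftArcCount t j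
leftArcCount-++ s t j = trans (cong length (LP.filter-++ _ s t)) (LP.length-++ (filter _ s))

leftArcCount-avoids : ∀ {s j} → All (λ x → proj₂ x ≢ j) s → leftArcCount s j ≡ 0
leftArcCount-avoids {j = j} ns =
  cong length (LP.filter-none _ (All.map (λ {x} ne → ne ∘ NP.≡ᵇ⇒≡ (proj₂ x) j ∘ ≡⇒T) ns))

leftArcCount-into : ∀ {t j} → All (λ x → proj₂ x ≡ j) t → leftArcCount t j ≡ length t
leftArcCount-into {j = j} es = cong length (LP.filter-all _ (All.map (λ { refl → ≡ᵇ-refl j }) es))

leftEnd-avoids : ∀ t j → All (λ x → proj₂ x ≢ j) t → leftEnd t j ≡ j
leftEnd-avoids []            j []        = refl
leftEnd-avoids ((i , k) ∷ t) j (ne ∷ ns) rewrite ≢⇒≡ᵇ-false ne = leftEnd-avoids t j ns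

leftEnd-++ˡ : ∀ s t j → All (λ x → proj₂ x ≢ j) t → leftEnd (s ++ t) j ≡ leftEnd s j
leftEnd-++ˡ []            t j ns = leftEnd-avoids t j ns
leftEnd-++ˡ ((i , k) ∷ s) t j ns = cong (if k ≡ᵇ j then i else_) (leftEnd-++ˡ s t j ns)

leftEnd-++ʳ : ∀ s t j → All (λ x → proj₂ x ≢ j) s → leftEnd (s ++ t) j ≡ leftEnd t j
leftEnd-++ʳ []            t j []        = refl
leftEnd-++ʳ ((i , k) ∷ s) t j (ne ∷ ns) rewrite ≢⇒≡ᵇ-false ne = leftEnd-++ʳ s t j ns

initLast-∷ʳ : ∀ (v : List A) c → initLast (v ∷ʳ c) ≡ (v ∷ʳ′ c)
initLast-∷ʳ []      c = refl
initLast-∷ʳ (x ∷ v) c rewrite initLast-∷ʳ v c = refl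

unsnoc-∷ʳ : ∀ (v : List A) c → unsnoc (v ∷ʳ c) ≡ just (v , c)
unsnoc-∷ʳ v c rewrite initLast-∷ʳ v c = refl

length-∷ʳ : ∀ (v : List A) c → length (v ∷ʳ c) ≡ suc (length v)
length-∷ʳ v c = trans (LP.length-++ v) (NP.+-comm (length v) 1)

nth-∷ʳ-old : ∀ (v : Word) c j → 1 ≤ j → j ≤ length v → nth (v ∷ʳ c) j ≡ nth v j
nth-∷ʳ-old (x ∷ v) c (suc zero)    _ _         = refl
nth-∷ʳ-old (x ∷ v) c (suc (suc j)) _ (s≤s j≤) = nth-∷ʳ-old v c (suc j) (s≤s z≤n) j≤

nth-∷ʳ-new : ∀ (v : Word) c → nth (v ∷ʳ c) (suc (length v)) ≡ just c
nth-∷ʳ-new []      c = refl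
nth-∷ʳ-new (x ∷ v) c = nth-∷ʳ-new v c

eqMaybe-sym : ∀ x y → eqMaybe x y ≡ eqMaybe y x
eqMaybe-sym (just x) (just y) = ≡ᵇ-sym x y
eqMaybe-sym (just x) nothing  = refl
eqMaybe-sym nothing  (just y) = refl
eqMaybe-sym nothing  nothing  = refl

eqMaybe-just⁻ : ∀ x c → eqMaybe x (just c) ≡ true → x ≡ just c
eqMaybe-just⁻ (just x) c e = cong just (NP.≡ᵇ⇒≡ x c (≡⇒T e))

copies : ℕ → ℕ → Word → ℕ → Bool
copies j N v c = (j <ᵇ N) ∧ (1 ≤ᵇ j) ∧ (length v ≡ᵇ (N ∸ 1)) ∧ eqMaybe (nth v j) (just c)

ind-∷ʳ : ∀ j N f v c → ind j N f (v ∷ʳ c) ≡ (if j ≡ᵇ N then f v else (if copies j N v c then f v else 0ℤ))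
ind-∷ʳ j N f v c with unsnoc (v ∷ʳ c) | unsnoc-∷ʳ v c
... | .(just (v , c)) | refl = refl

ind-top : ∀ N f v c → ind N N f (v ∷ʳ c) ≡ f v
ind-top N f v c = trans (ind-∷ʳ N N f v c) (cong (if_then f v else (if copies N N v c then f v else 0ℤ)) (≡ᵇ-refl N))

ind-below : ∀ {j N} f v c → j ≢ N → ind j N f (v ∷ʳ c) ≡ (if copies j N v c then f v else 0ℤ)
ind-below {j} {N} f v c j≢N = trans (ind-∷ʳ j N f v c) (cong (if_then f v else (if copies j N v c then f v else 0ℤ)) (≢⇒≡ᵇ-false j≢N))

ind-cong : ∀ j N {f g : Series} → (∀ v → f v ≡ g v) → ∀ u → ind j N f u ≡ ind j N g u
ind-cong j N f≗g u with unsnoc u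
... | nothing      = refl
... | just (v , c) rewrite f≗g v = refl

e₁↑-cong : ∀ m D D′ → (∀ j → j ≤ suc m → leftEnd D j ≡ leftEnd D′ j) → ∀ w → e₁↑ D m w ≡ e₁↑ D′ m w
e₁↑-cong zero    D D′ same w = refl
e₁↑-cong (suc m) D D′ same w rewrite same (suc (suc m)) NP.≤-refl =
  ind-cong _ _ (e₁↑-cong m D D′ (λ j j≤ → same j (NP.m≤n⇒m≤1+n j≤))) w

e₁↑-noArcInto : ∀ m s v c → EndsBy (suc m) s → e₁↑ s (suc m) (v ∷ʳ c) ≡ e₁↑ s m v
e₁↑-noArcInto m s v c ends =
  trans (cong (λ j → ind j (suc (suc m)) (e₁↑ s m) (v ∷ʳ c)) (leftEnd-avoids s _ (endsBy⇒avoids ends NP.≤-refl)))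
        (ind-top (suc (suc m)) (e₁↑ s m) v c)

e₁↑-arcInto : ∀ m s i v c → EndsBy (suc m) s → i ≤ suc m →
  e₁↑ (s ++ [ (i , suc (suc m)) ]) (suc m) (v ∷ʳ c) ≡ (if copies i (suc (suc m)) v c then e₁↑ s m v else 0ℤ)
e₁↑-arcInto m s i v c ends i≤ = begin
    ind (leftEnd (s ++ [ x ]) N) N (e₁↑ (s ++ [ x ]) m) (v ∷ʳ c)
  ≡⟨ cong (λ j → ind j N (e₁↑ (s ++ [ x ]) m) (v ∷ʳ c)) (leftEnd-++ʳ s [ x ] N (endsBy⇒avoids ends NP.≤-refl)) ⟩
    ind (if N ≡ᵇ N then i else N) N (e₁↑ (s ++ [ x ]) m) (v ∷ʳ c)
  ≡⟨ cong (λ b → ind (if b then i else N) N (e₁↑ (s ++ [ x ]) m) (v ∷ʳ c)) (≡ᵇ-refl N) ⟩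
    ind i N (e₁↑ (s ++ [ x ]) m) (v ∷ʳ c)
  ≡⟨ ind-below (e₁↑ (s ++ [ x ]) m) v c (NP.<⇒≢ (s≤s i≤)) ⟩
    (if copies i N v c then e₁↑ (s ++ [ x ]) m v else 0ℤ)
  ≡⟨ cong (if copies i N v c then_else 0ℤ) (e₁↑-cong m (s ++ [ x ]) s earlier v) ⟩
    (if copies i N v c then e₁↑ s m v else 0ℤ)
  ∎
  where
  open ≡-Reasoning
  N : ℕ
  N = suc (suc m)
  x : ℕ × ℕ
  x = (i , N)
  earlier : ∀ j → j ≤ suc m → leftEnd (s ++ [ x ]) j ≡ leftEnd s j
  earlier j j≤ = leftEnd-++ˡ s [ x ] j ((λ N≡j → NP.<⇒≱ (s≤s j≤) (NP.≤-reflexive N≡j)) ∷ [])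

negate-if-∧ : ∀ x y z (p e : ℤ) →
  (if x ∧ y then (-1ℤ *ℤ p) *ℤ (if z then e else 0ℤ) else 0ℤ) ≡ 𝟙 (y ∧ z) *ℤ (- (if x then p *ℤ e else 0ℤ))
negate-if-∧ false true  true  p e = refl
negate-if-∧ false true  false p e = refl
negate-if-∧ false false z     p e = refl
negate-if-∧ true  false z     p e = sym (ZP.*-zeroˡ (- (p *ℤ e)))
negate-if-∧ true  true  false p e = ZP.*-zeroʳ (-1ℤ *ℤ p)
negate-if-∧ true  true  true  p e = rearrange p e
  where
  rearrange : ∀ p e → (-1ℤ *ℤ p) *ℤ e ≡ 1ℤ *ℤ (- (p *ℤ e))
  rearrange = solve-∀

*-𝟙-∧ : ∀ (k : ℤ) l p p′ b → (l ≡ true → p′ ≡ p ∧ b) → (l ≡ true → p ≡ true → 𝟙 b ≡ k) →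
  k *ℤ 𝟙 (l ∧ p) ≡ 𝟙 (l ∧ p′)
*-𝟙-∧ k false p p′ b split value = ZP.*-zeroʳ k
*-𝟙-∧ k true  p p′ b split value rewrite split refl with p
... | false = ZP.*-zeroʳ k
... | true  = trans (ZP.*-identityʳ k) (sym (value refl refl))

inIv⁻ : ∀ {lo hi x} → T (inIv lo hi x) → lo ≤ x × x ≤ hi
inIv⁻ {lo} {hi} {x} t = let p , q = Equivalence.to BP.T-∧ t in NP.≤ᵇ⇒≤ lo x p , NP.≤ᵇ⇒≤ x hi q

inIv⁺ : ∀ {lo hi x} → lo ≤ x → x ≤ hi → T (inIv lo hi x)
inIv⁺ p q = Equivalence.from BP.T-∧ (NP.≤⇒≤ᵇ p , NP.≤⇒≤ᵇ q)

inIv-pair⁻ : ∀ {lo hi x y} → T (inIv lo hi x ∧ inIv lo hi y) → (lo ≤ x × x ≤ hi) × (lo ≤ y × y ≤ hi)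
inIv-pair⁻ t = let p , q = Equivalence.to BP.T-∧ t in inIv⁻ p , inIv⁻ q

module InducedSubgraph (a : ℕ → ℕ) (n : ℕ) where

  shared : ℕ → ℕ → Bool
  shared = sameInterval a n

  shared-sym : ∀ x y → shared x y ≡ shared y x
  shared-sym x y = cong or (LP.map-cong (λ k → BP.∧-comm (inIv (a k) k x) _) (range n))

  shared⁺ : ∀ {k x y} → k ∈ range n → a k ≤ x → x ≤ k → a k ≤ y → y ≤ k → shared x y ≡ true
  shared⁺ k∈ p q p′ q′ = T⇒≡ (AnyP.any⁺ _ (lose k∈ (Equivalence.from BP.T-∧ (inIv⁺ p q , inIv⁺ p′ q′))))

  -- Of two intervals [a k, k] ∋ N and [a k′, k′] ∋ N, the one with the smaller left end contains x and y.
  shared-clique : ∀ {x y N} → x ≤ N → y ≤ N → shared x N ≡ true → shared y N ≡ true → shared x y ≡ true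
  shared-clique {x} {y} {N} x≤N y≤N xN yN
    with find (AnyP.any⁻ _ (range n) (≡⇒T xN)) | find (AnyP.any⁻ _ (range n) (≡⇒T yN))
  ... | k , k∈ , xNk | k′ , k′∈ , yNk′
    with inIv-pair⁻ xNk | inIv-pair⁻ yNk′ | NP.≤-total (a k) (a k′)
  ... | (ak≤x , x≤k) , (_ , N≤k) | (ak′≤y , y≤k′) , (_ , N≤k′) | inj₁ ak≤ak′ =
    shared⁺ k∈ ak≤x x≤k (NP.≤-trans ak≤ak′ ak′≤y) (NP.≤-trans y≤N N≤k)
  ... | (ak≤x , x≤k) , (_ , N≤k) | (ak′≤y , y≤k′) , (_ , N≤k′) | inj₂ ak′≤ak =
    shared⁺ k′∈ (NP.≤-trans ak′≤ak ak≤x) (NP.≤-trans x≤N N≤k′) ak′≤y y≤k′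

  compatible : Word → ℕ → ℕ → Bool
  compatible w i j = not (adj a n i j) ∨ not (eqMaybe (nth w i) (nth w j))

  properOn : ℕ → Word → Bool
  properOn m w = all (λ i → all (compatible w i) (range m)) (range m)

  Y↾ : ℕ → Series
  Y↾ m w = 𝟙 ((length w ≡ᵇ m) ∧ properOn m w)

  compatible-sym : ∀ w i j → compatible w i j ≡ compatible w j i
  compatible-sym w i j = cong₂ (λ p q → not p ∨ not q)
    (cong₂ (λ e s → not e ∧ s) (≡ᵇ-sym i j) (shared-sym i j)) (eqMaybe-sym (nth w i) (nth w j))

  compatible-refl : ∀ w i → compatible w i i ≡ true
  compatible-refl w i rewrite ≡ᵇ-refl i = refl

  clash : ℕ → Word → ℕ → ℕ → Bool
  clash N v c i = shared i N ∧ eqMaybe (nth v i) (just c)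

  compatible-∷ʳ-old : ∀ v c {i j} → 1 ≤ i × i ≤ length v → 1 ≤ j × j ≤ length v →
    compatible (v ∷ʳ c) i j ≡ compatible v i j
  compatible-∷ʳ-old v c {i} {j} (1≤i , i≤) (1≤j , j≤)
    rewrite nth-∷ʳ-old v c i 1≤i i≤ | nth-∷ʳ-old v c j 1≤j j≤ = refl

  compatible-∷ʳ-new : ∀ v c {i} → 1 ≤ i × i ≤ length v →
    compatible (v ∷ʳ c) i (suc (length v)) ≡ not (clash (suc (length v)) v c i)
  compatible-∷ʳ-new v c {i} (1≤i , i≤)
    rewrite ≢⇒≡ᵇ-false (NP.<⇒≢ (s≤s i≤)) | nth-∷ʳ-old v c i 1≤i i≤ | nth-∷ʳ-new v c =
    sym (deMorgan₁ (shared i (suc (length v))) (eqMaybe (nth v i) (just c)))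

  properOn-∷ʳ : ∀ {M} v c → length v ≡ M →
    properOn (suc M) (v ∷ʳ c) ≡ properOn M v ∧ all (not ∘ clash (suc M) v c) (range M)
  properOn-∷ʳ {M} v c refl = begin
      all (λ i → all (compatible u i) (range N)) (range N)
    ≡⟨ cong (λ R → all (λ i → all (compatible u i) R) R) (range-suc M) ⟩
      all (λ i → all (compatible u i) R′) R′
    ≡⟨ all-++ _ R [ N ] ⟩
      all (λ i → all (compatible u i) R′) R ∧ (all (compatible u N) R′ ∧ true)
    ≡⟨ cong₂ (λ x y → x ∧ (y ∧ true)) (all-cong R (All.map oldRow (range-bounds M))) newRow ⟩
      all (λ i → all (compatible v i) R ∧ not (clash N v c i)) R ∧ ((noClash ∧ true) ∧ true)
    ≡⟨ cong₂ _∧_ (all-∧ _ _ R) (trans (BP.∧-identityʳ _) (BP.∧-identityʳ noClash)) ⟩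
      (properOn M v ∧ noClash) ∧ noClash
    ≡⟨ BP.∧-assoc (properOn M v) noClash noClash ⟩
      properOn M v ∧ (noClash ∧ noClash)
    ≡⟨ cong (properOn M v ∧_) (BP.∧-idem noClash) ⟩
      properOn M v ∧ noClash
    ∎
    where
    open ≡-Reasoning
    u : Word
    u = v ∷ʳ c
    N : ℕ
    N = suc M
    R R′ : List ℕ
    R = range M
    R′ = R ++ [ N ]
    noClash : Bool
    noClash = all (not ∘ clash N v c) R
    oldRow : ∀ {i} → 1 ≤ i × i ≤ M → all (compatible u i) R′ ≡ all (compatible v i) R ∧ not (clash N v c i)
    oldRow i∈ = trans (all-++ (compatible u _) R [ N ])
      (cong₂ _∧_ (all-cong R (All.map (compatible-∷ʳ-old v c i∈) (range-bounds M)))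
                 (trans (BP.∧-identityʳ _) (compatible-∷ʳ-new v c i∈)))
    newRow : all (compatible u N) R′ ≡ noClash ∧ true
    newRow = trans (all-++ (compatible u N) R [ N ])
      (cong₂ _∧_ (all-cong R (All.map (λ {j} j∈ → trans (compatible-sym u N j) (compatible-∷ʳ-new v c j∈)) (range-bounds M)))
                 (cong (_∧ true) (compatible-refl u N)))

  compatible-clash : ∀ w {x y c} → x ≢ y → shared x y ≡ true → nth w x ≡ just c → nth w y ≡ just c →
    compatible w x y ≡ false
  compatible-clash w {c = c} x≢y sxy wx wy rewrite ≢⇒≡ᵇ-false x≢y | sxy | wx | wy | ≡ᵇ-refl c = refl

  clash-exclusive : ∀ {M} v c → properOn M v ≡ true →
    AllPairs (λ x y → clash (suc M) v c x ∧ clash (suc M) v c y ≡ false) (range M)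
  clash-exclusive {M} v c proper = AllPairsP.applyUpTo⁺₁ suc M
    (λ i<j j<M → exclusive (∈-range⁺ (NP.<-trans i<j j<M)) (∈-range⁺ j<M) (NP.<⇒≢ (s≤s i<j)))
    where
    exclusive : ∀ {x y} → x ∈ range M → y ∈ range M → x ≢ y → clash (suc M) v c x ∧ clash (suc M) v c y ≡ false
    exclusive {x} {y} x∈ y∈ x≢y with clash (suc M) v c x in cx | clash (suc M) v c y in cy
    ... | false | _     = refl
    ... | true  | false = refl
    ... | true  | true  = ⊥-elim (BP.not-¬ incompatible (all-∈ (all-∈ proper x∈) y∈))
      where
      xN : shared x (suc M) ≡ true × eqMaybe (nth v x) (just c) ≡ true
      xN = ∧-true⁻ cx
      yN : shared y (suc M) ≡ true × eqMaybe (nth v y) (just c) ≡ true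
      yN = ∧-true⁻ cy
      incompatible : compatible v x y ≡ false
      incompatible = compatible-clash v x≢y
        (shared-clique (NP.m≤n⇒m≤1+n (proj₂ (∈-range⁻ x∈))) (NP.m≤n⇒m≤1+n (proj₂ (∈-range⁻ y∈))) (proj₁ xN) (proj₁ yN))
        (eqMaybe-just⁻ (nth v x) c (proj₂ xN)) (eqMaybe-just⁻ (nth v y) c (proj₂ yN))

  copies-inRange : ∀ {M} v c {i} → (length v ≡ᵇ M) ≡ true → 1 ≤ i × i ≤ M →
    copies i (suc M) v c ≡ eqMaybe (nth v i) (just c)
  copies-inRange v c {suc i} lv (_ , i≤) rewrite <⇒<ᵇ-true (s≤s i≤) | lv = refl

  conflicts : ℕ → Word → ℕ → ℤ
  conflicts M v c = sumℤ (map (λ i → 𝟙 (shared i (suc M) ∧ copies i (suc M) v c)) (range M))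

  Y↾-∷ʳ : ∀ M v c → (1ℤ -ℤ conflicts M v c) *ℤ Y↾ M v ≡ Y↾ (suc M) (v ∷ʳ c)
  Y↾-∷ʳ M v c =
    trans (*-𝟙-∧ (1ℤ -ℤ conflicts M v c) (length v ≡ᵇ M) (properOn M v) _ noClash
                  (λ lv → properOn-∷ʳ v c (NP.≡ᵇ⇒≡ _ _ (≡⇒T lv))) count)
          (cong (λ k → 𝟙 ((k ≡ᵇ suc M) ∧ properOn (suc M) (v ∷ʳ c))) (sym (length-∷ʳ v c)))
    where
    noClash : Bool
    noClash = all (not ∘ clash (suc M) v c) (range M)
    count : (length v ≡ᵇ M) ≡ true → properOn M v ≡ true → 𝟙 noClash ≡ 1ℤ -ℤ conflicts M v c
    count lv proper = trans (𝟙-none-exclusive (clash (suc M) v c) (range M) (clash-exclusive v c proper))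
      (cong (1ℤ -ℤ_) (sumℤ-map-cong (range M)
        (All.map (λ i∈ → cong (λ b → 𝟙 (shared _ (suc M) ∧ b)) (sym (copies-inRange v c lv i∈))) (range-bounds M))))

  atMostOneLeftArc : ArcDiagram → Bool
  atMostOneLeftArc D = all (λ j → leftArcCount D j ≤ᵇ 1) (range n)

  arcsShareInterval : ArcDiagram → Bool
  arcsShareInterval D = all (λ { (i , j) → shared i j }) D

  inA-[] : inA a n [] ≡ true
  inA-[] = cong (_∧ true) (all-true {p = λ j → leftArcCount [] j ≤ᵇ 1} (range n) (AllP.applyUpTo⁺₂ suc n (λ _ → refl)))

  inA-∷ʳ-arcInto : ∀ {M} s i → EndsBy M s → inA a n (s ++ [ (i , suc M) ]) ≡ inA a n s ∧ shared i (suc M)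
  inA-∷ʳ-arcInto {M} s i ends = begin
      atMostOneLeftArc (s ++ [ x ]) ∧ arcsShareInterval (s ++ [ x ])
    ≡⟨ cong₂ _∧_ (all-cong (range n) (AllP.applyUpTo⁺₂ suc n (λ j → sameCount (suc j)))) (all-++ _ s [ x ]) ⟩
      atMostOneLeftArc s ∧ (arcsShareInterval s ∧ (shared i (suc M) ∧ true))
    ≡⟨ cong (λ b → atMostOneLeftArc s ∧ (arcsShareInterval s ∧ b)) (BP.∧-identityʳ _) ⟩
      atMostOneLeftArc s ∧ (arcsShareInterval s ∧ shared i (suc M))
    ≡⟨ sym (BP.∧-assoc (atMostOneLeftArc s) _ _) ⟩
      inA a n s ∧ shared i (suc M)
    ∎
    where
    open ≡-Reasoning
    x : ℕ × ℕ
    x = (i , suc M)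
    noneInto : leftArcCount s (suc M) ≡ 0
    noneInto = leftArcCount-avoids (endsBy⇒avoids ends NP.≤-refl)
    sameCount : ∀ j → (leftArcCount (s ++ [ x ]) j ≤ᵇ 1) ≡ (leftArcCount s j ≤ᵇ 1)
    sameCount j with j NP.≟ suc M
    ... | yes refl rewrite leftArcCount-++ s [ x ] j | noneInto | leftArcCount-into {t = [ x ]} (refl ∷ []) = refl
    ... | no j≢ rewrite leftArcCount-++ s [ x ] j | leftArcCount-avoids {s = [ x ]} ((j≢ ∘ sym) ∷ [])
                      | NP.+-identityʳ (leftArcCount s j) = refl

  inA-twoArcsInto : ∀ {M} s t → suc M ≤ n → EndsBy M s → All (λ x → proj₂ x ≡ suc M) t → 2 ≤ length t →
    inA a n (s ++ t) ≡ false
  inA-twoArcsInto {M} s t M<n ends into 2≤ = cong (_∧ arcsShareInterval (s ++ t))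
    (all-false {p = λ j → leftArcCount (s ++ t) j ≤ᵇ 1} (∈-range⁺ M<n) tooMany)
    where
    tooMany : (leftArcCount (s ++ t) (suc M) ≤ᵇ 1) ≡ false
    tooMany rewrite leftArcCount-++ s t (suc M) | leftArcCount-avoids (endsBy⇒avoids ends NP.≤-refl)
                  | leftArcCount-into into = BP.¬-not (λ le → NP.<⇒≱ 2≤ (NP.≤ᵇ⇒≤ _ 1 (≡⇒T le)))

  signedTerm : ℕ → ArcDiagram → Series
  signedTerm k D w = if inA a n D then (-1ℤ ^ arcCount D) *ℤ e₁↑ D k w else 0ℤ

  signedTerm-noArcInto : ∀ m s v c → EndsBy (suc m) s → signedTerm (suc m) s (v ∷ʳ c) ≡ signedTerm m s v
  signedTerm-noArcInto m s v c ends =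
    cong (λ z → if inA a n s then (-1ℤ ^ arcCount s) *ℤ z else 0ℤ) (e₁↑-noArcInto m s v c ends)

  signedTerm-arcInto : ∀ m s i v c → EndsBy (suc m) s → i ≤ suc m →
    signedTerm (suc m) (s ++ [ (i , suc (suc m)) ]) (v ∷ʳ c) ≡
    𝟙 (shared i (suc (suc m)) ∧ copies i (suc (suc m)) v c) *ℤ (- signedTerm m s v)
  signedTerm-arcInto m s i v c ends i≤ =
    trans (signedTerm-cong (inA-∷ʳ-arcInto s i ends) (length-∷ʳ s (i , suc (suc m)))
                           (e₁↑-arcInto m s i v c ends i≤))
          (negate-if-∧ (inA a n s) (shared i (suc (suc m))) (copies i (suc (suc m)) v c) (-1ℤ ^ arcCount s) (e₁↑ s m v))
    where
    signedTerm-cong : ∀ {b b′ k k′ z z′} → b ≡ b′ → k ≡ k′ → z ≡ z′ →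
      (if b then (-1ℤ ^ k) *ℤ z else 0ℤ) ≡ (if b′ then (-1ℤ ^ k′) *ℤ z′ else 0ℤ)
    signedTerm-cong refl refl refl = refl

  sumℤ-arcsInto : ∀ m → suc (suc m) ≤ n → ∀ s v c → EndsBy (suc m) s →
    sumℤ (map (λ t → signedTerm (suc m) (s ++ t) (v ∷ʳ c)) (sublists (arcsInto (suc (suc m))))) ≡
    (1ℤ -ℤ conflicts (suc m) v c) *ℤ signedTerm m s v
  sumℤ-arcsInto m N≤n s v c ends = begin
      sumℤ (map term (sublists (arcsInto N)))
    ≡⟨ sumℤ-sublists-singletons (λ x → proj₂ x ≡ N) term (arcsInto N) (arcsInto-target N)
         (λ t into 2≤ → cong (if_then _ else 0ℤ) (inA-twoArcsInto s t N≤n ends into 2≤)) ⟩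
      term [] +ℤ sumℤ (map (λ x → term [ x ]) (arcsInto N))
    ≡⟨ cong₂ _+ℤ_ (trans (cong (λ D → signedTerm (suc m) D (v ∷ʳ c)) (LP.++-identityʳ s))
                         (signedTerm-noArcInto m s v c ends))
                  (trans (sumℤ-map-∘ (λ x → term [ x ]) (λ i → (i , N)) (range (suc m)))
                         (sumℤ-map-cong (range (suc m))
                           (All.map (λ i∈ → signedTerm-arcInto m s _ v c ends (proj₂ i∈)) (range-bounds (suc m))))) ⟩
      X +ℤ sumℤ (map (λ i → 𝟙 (shared i N ∧ copies i N v c) *ℤ (- X)) (range (suc m)))
    ≡⟨ cong (X +ℤ_) (sumℤ-map-*ʳ (- X) (λ i → 𝟙 (shared i N ∧ copies i N v c)) (range (suc m))) ⟩
      X +ℤ conflicts (suc m) v c *ℤ (- X)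
    ≡⟨ collect X (conflicts (suc m) v c) ⟩
      (1ℤ -ℤ conflicts (suc m) v c) *ℤ X
    ∎
    where
    open ≡-Reasoning
    N : ℕ
    N = suc (suc m)
    X : ℤ
    X = signedTerm m s v
    term : ArcDiagram → ℤ
    term t = signedTerm (suc m) (s ++ t) (v ∷ʳ c)
    collect : ∀ x k → x +ℤ k *ℤ (- x) ≡ (1ℤ -ℤ k) *ℤ x
    collect = solve-∀

  -- The right-hand side for the subgraph induced on [m + 1] (e₁↑ D m performs m inductions).
  RHS↾ : ℕ → Series
  RHS↾ m w = sumℤ (map (λ D → signedTerm m D w) (sublists (allArcs (suc m))))

  RHS↾-∷ʳ : ∀ m → suc (suc m) ≤ n → ∀ v c → RHS↾ (suc m) (v ∷ʳ c) ≡ (1ℤ -ℤ conflicts (suc m) v c) *ℤ RHS↾ m v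
  RHS↾-∷ʳ m N≤n v c = begin
      sumℤ (map (λ D → signedTerm (suc m) D (v ∷ʳ c)) (sublists (allArcs (suc (suc m)))))
    ≡⟨ cong (λ L → sumℤ (map (λ D → signedTerm (suc m) D (v ∷ʳ c)) (sublists L))) (allArcs-suc (suc m)) ⟩
      sumℤ (map (λ D → signedTerm (suc m) D (v ∷ʳ c)) (sublists (allArcs (suc m) ++ arcsInto (suc (suc m)))))
    ≡⟨ sumℤ-sublists-++ (λ D → signedTerm (suc m) D (v ∷ʳ c)) (allArcs (suc m)) (arcsInto (suc (suc m))) ⟩
      sumℤ (map (λ s → sumℤ (map (λ t → signedTerm (suc m) (s ++ t) (v ∷ʳ c)) (sublists (arcsInto (suc (suc m))))))
                (sublists (allArcs (suc m))))
    ≡⟨ sumℤ-map-cong (sublists (allArcs (suc m)))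
         (All.map (sumℤ-arcsInto m N≤n _ v c) (All-sublists (allArcs (suc m)) (allArcs-endsBy (suc m)))) ⟩
      sumℤ (map (λ s → (1ℤ -ℤ conflicts (suc m) v c) *ℤ signedTerm m s v) (sublists (allArcs (suc m))))
    ≡⟨ sumℤ-map-*ˡ (1ℤ -ℤ conflicts (suc m) v c) (λ s → signedTerm m s v) (sublists (allArcs (suc m))) ⟩
      (1ℤ -ℤ conflicts (suc m) v c) *ℤ RHS↾ m v
    ∎
    where open ≡-Reasoning

  RHS↾-one-vertex : ∀ w → RHS↾ 0 w ≡ Y↾ 1 w
  RHS↾-one-vertex w rewrite inA-[] = e₁-one-vertex w
    where
    e₁-one-vertex : ∀ w → 1ℤ *ℤ e₁ w +ℤ 0ℤ ≡ Y↾ 1 w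
    e₁-one-vertex []          = refl
    e₁-one-vertex (x ∷ [])    = refl
    e₁-one-vertex (x ∷ y ∷ w) = refl

  RHS↾-[] : ∀ m → RHS↾ (suc m) [] ≡ 0ℤ
  RHS↾-[] m = sumℤ-map-zero (sublists (allArcs (suc (suc m)))) (All.universal vanish _)
    where
    vanish : ∀ D → signedTerm (suc m) D [] ≡ 0ℤ
    vanish D with inA a n D
    ... | true  = ZP.*-zeroʳ (-1ℤ ^ arcCount D)
    ... | false = refl

  RHS↾≡Y↾ : ∀ m → suc m ≤ n → ∀ w → RHS↾ m w ≡ Y↾ (suc m) w
  RHS↾≡Y↾ zero    _   w = RHS↾-one-vertex w
  RHS↾≡Y↾ (suc m) N≤n w = byLastLetter w (initLast w)
    where
    open ≡-Reasoning
    byLastLetter : ∀ w → InitLast w → RHS↾ (suc m) w ≡ Y↾ (suc (suc m)) w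
    byLastLetter .[]        []        = RHS↾-[] m
    byLastLetter .(v ∷ʳ c) (v ∷ʳ′ c) = begin
        RHS↾ (suc m) (v ∷ʳ c)
      ≡⟨ RHS↾-∷ʳ m N≤n v c ⟩
        (1ℤ -ℤ conflicts (suc m) v c) *ℤ RHS↾ m v
      ≡⟨ cong ((1ℤ -ℤ conflicts (suc m) v c) *ℤ_) (RHS↾≡Y↾ m (NP.<⇒≤ N≤n) v) ⟩
        (1ℤ -ℤ conflicts (suc m) v c) *ℤ Y↾ (suc m) v
      ≡⟨ Y↾-∷ʳ (suc m) v c ⟩
        Y↾ (suc (suc m)) (v ∷ʳ c)
      ∎

proposition3p2 : (n : ℕ) → 1 ≤ n → (a : ℕ → ℕ)
    → (∀ k → 1 ≤ k → k ≤ n → 1 ≤ a k × a k ≤ k)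
    → ∀ (w : Word) → Y a n w ≡ RHS a n w
proposition3p2 zero    ()  a _ w
proposition3p2 (suc n) _   a _ w = sym (begin
    RHS a (suc n) w
  ≡⟨ sumℤ-map-filter (inA a (suc n)) (λ D → (-1ℤ ^ arcCount D) *ℤ e₁↑_D D (suc n) w) (arcDiagrams (suc n)) ⟩
    RHS↾ n w
  ≡⟨ RHS↾≡Y↾ n NP.≤-refl w ⟩
    Y↾ (suc n) w
  ∎)
  where
  open ≡-Reasoning
  open InducedSubgraph a (suc n)
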